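{- Let $n\ge 2$ be an integer and let $X_n$ be the unitary Cayley graph on $\mathbb{Z}_n$. Then $X_n$ is a crown graph if and only if $n=2p$ for some odd prime $p$.
   Context: For an integer $n\ge 2$, let $U_n=\{k : 1\le k\le n,\ \gcd(k,n)=1\}\subseteq \mathbb{Z}_n$. The unitary Cayley graph $X_n=\mathrm{Cay}(\mathbb{Z}_n,U_n)$ has vertex set $\mathbb{Z}_n$, with $x,y$ adjacent iff $x-y \pmod n\in U_n$. A crown graph is a complete bipartite graph $K_{m,m}$ with the edges of a perfect matching (1-factor) removed. -}

module Defs where

open import Data.Nat using (ℕ; zero; suc; _+_; _∸_; _%_)
open import Data.Nat.GCD using (gcd)
open import Data.Fin using (Fin; toℕ)
open import Data.Product using (Σ-syntax; _×_; _,_)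
open import Relation.Binary.PropositionalEquality using (_≡_; _≢_)
open import Function.Bundles using (_↔_; _⇔_; Inverse)

diffMod : (n : ℕ) → Fin n → Fin n → ℕ
diffMod (suc k) x y = (toℕ x + (suc k ∸ toℕ y)) % suc k

-- Unitary Cayley graph X_n = Cay(Z_n, U_n) on vertex set Fin n:
-- x ~ y iff (x - y mod n) ∈ U_n, i.e. gcd((x - y) mod n, n) = 1.
-- (The element n of U_n's range [1,n] is residue 0, and gcd(0,n) = n ≠ 1
-- for n ≥ 2, so this matches the definition exactly.)
UnitaryAdj : (n : ℕ) → Fin n → Fin n → Set
UnitaryAdj n x y = gcd (diffMod n x y) n ≡ 1

-- Crown graph on m + m vertices: K_{m,m} minus a perfect matching.
-- Vertices (side, index) with side ∈ Fin 2; (i,a) ~ (j,b) iff i ≠ j and a ≠ b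
-- (the removed perfect matching is {(0,a),(1,a)}).
CrownAdj : (m : ℕ) → Fin 2 × Fin m → Fin 2 × Fin m → Set
CrownAdj m (i , a) (j , b) = (i ≢ j) × (a ≢ b)

IsCrownUnitary : ℕ → Set
IsCrownUnitary n =
  Σ[ m ∈ ℕ ] Σ[ f ∈ (Fin n ↔ (Fin 2 × Fin m)) ]
    (∀ x y → UnitaryAdj n x y ⇔ CrownAdj m (Inverse.to f x) (Inverse.to f y))

{-# OPTIONS --safe #-}
-- A crown graph has two sides, and x, x + 1 are adjacent in X_n, so the side of a
-- residue x is determined by the parity of x; the edge between n - 1 and 0 then
-- forces n to be even. Every vertex has exactly one non-neighbour on the other side,
-- so the partner w of 0 is the only odd residue that is not a unit mod n. As n - w
-- and every nontrivial divisor of w are again odd non-units, n - w = w and w is prime.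
-- Conversely, for n = 2p the Chinese remainder map x ↦ (x mod 2, x mod p) is a crown
-- isomorphism, because x - y is a unit mod 2p iff it is odd and prime to p.
module Submission where

open import Defs
open import Data.Nat using (ℕ; zero; suc; _+_; _*_; _∸_; _%_; _<_; _≤_; z≤n; s≤s;
  NonZero; ≢-nonZero; n>1⇒nonTrivial; parity)
open import Data.Nat.Properties
open import Data.Nat.DivMod
open import Data.Nat.Divisibility
open import Data.Nat.GCD using (gcd; gcd-zeroˡ)
open import Data.Nat.Coprimality using (Coprime; coprime-divisor; coprime⇒gcd≡1; gcd≡1⇒coprime)
open import Data.Nat.Primality using (Prime; Irreducible; prime⇒nonZero; prime⇒irreducible;
  irreducible⇒prime; ¬prime[1]; prime[2])
open import Data.Parity.Base as ℙ using (Parity; 0ℙ; 1ℙ; _⁻¹)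
import Data.Parity.Properties as ℙₚ
open import Data.Fin as F using (Fin; toℕ; fromℕ; fromℕ<)
open import Data.Fin.Properties using (toℕ-injective; toℕ-fromℕ; toℕ-fromℕ<; fromℕ<-toℕ; toℕ<n;
  toℕ-combine; combine-remQuot; *↔×)
open import Data.Product using (Σ-syntax; _×_; _,_; proj₁; proj₂)
open import Data.Product.Function.NonDependent.Propositional using (_×-⇔_)
open import Data.Sum using (inj₁; inj₂)
open import Function.Base using (_∘_; case_of_)
open import Function.Bundles using (_⇔_; mk⇔; Equivalence; _↔_; mk↔ₛ′; Inverse)
open import Function.Construct.Composition using (_↔-∘_)
open import Function.Construct.Symmetry using (⇔-sym)
open import Function.Related.Propositional using (module EquationalReasoning)
open import Function.Related.TypeIsomorphisms using (¬-cong-⇔)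
open import Relation.Nullary using (¬_; yes; no; contradiction)
open import Relation.Nullary.Decidable using (decidable-stable)
open import Relation.Binary.PropositionalEquality
  using (_≡_; _≢_; refl; sym; trans; cong; cong₂; subst; module ≡-Reasoning)

≢⇒≡⁻¹ : ∀ {x y : Parity} → x ≢ y → x ≡ y ⁻¹
≢⇒≡⁻¹ {0ℙ} {0ℙ} x≢y = contradiction refl x≢y
≢⇒≡⁻¹ {0ℙ} {1ℙ} _   = refl
≢⇒≡⁻¹ {1ℙ} {0ℙ} _   = refl
≢⇒≡⁻¹ {1ℙ} {1ℙ} x≢y = contradiction refl x≢y

x*y≡1ℙ⇒y≡1ℙ : ∀ {x y : Parity} → x ℙ.* y ≡ 1ℙ → y ≡ 1ℙ
x*y≡1ℙ⇒y≡1ℙ {1ℙ} e = e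

x+y+y≡x : ∀ x y → x ℙ.+ y ℙ.+ y ≡ x
x+y+y≡x x y = begin
  x ℙ.+ y ℙ.+ y    ≡⟨ ℙₚ.+-assoc x y y ⟩
  x ℙ.+ (y ℙ.+ y)  ≡⟨ cong (x ℙ.+_) (ℙₚ.p+p≡0ℙ y) ⟩
  x ℙ.+ 0ℙ         ≡⟨ ℙₚ.+-identityʳ x ⟩
  x                ∎
  where open ≡-Reasoning

parity≡parity[%2] : ∀ n → parity n ≡ parity (n % 2)
parity≡parity[%2] zero          = refl
parity≡parity[%2] (suc zero)    = refl
parity≡parity[%2] (suc (suc n)) =
  trans (parity≡parity[%2] n) (cong parity (sym (%-remove-+ˡ n (∣-refl {2}))))

parity-injective-<2 : ∀ {r s} → r < 2 → s < 2 → parity r ≡ parity s → r ≡ s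
parity-injective-<2 {0}     {0}     _ _ _  = refl
parity-injective-<2 {1}     {1}     _ _ _  = refl
parity-injective-<2 {0}     {1}     _ _ ()
parity-injective-<2 {1}     {0}     _ _ ()
parity-injective-<2 {suc (suc _)} (s≤s (s≤s ()))
parity-injective-<2 {_} {suc (suc _)} _ (s≤s (s≤s ()))

parity≡⇔%2≡ : ∀ m n → parity m ≡ parity n ⇔ m % 2 ≡ n % 2
parity≡⇔%2≡ m n = mk⇔
  (λ e → parity-injective-<2 (m%n<n m 2) (m%n<n n 2)
           (trans (sym (parity≡parity[%2] m)) (trans e (parity≡parity[%2] n))))
  (λ e → trans (parity≡parity[%2] m) (trans (cong parity e) (sym (parity≡parity[%2] n))))

parity≡0ℙ⇒2∣ : ∀ {n} → parity n ≡ 0ℙ → 2 ∣ n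
parity≡0ℙ⇒2∣ {n} e = m%n≡0⇒n∣m n 2 (Equivalence.to (parity≡⇔%2≡ n 0) e)

∣⇒parity≡1ℙ : ∀ {d m} → d ∣ m → parity m ≡ 1ℙ → parity d ≡ 1ℙ
∣⇒parity≡1ℙ {d} (divides q refl) e = x*y≡1ℙ⇒y≡1ℙ (trans (sym (ℙₚ.*-homo-* q d)) e)

fromParity : Parity → Fin 2
fromParity 0ℙ = F.zero
fromParity 1ℙ = F.suc F.zero

parity-toℕ-fromParity : ∀ x → parity (toℕ (fromParity x)) ≡ x
parity-toℕ-fromParity 0ℙ = refl
parity-toℕ-fromParity 1ℙ = refl

fromParity-parity-toℕ : ∀ (i : Fin 2) → fromParity (parity (toℕ i)) ≡ i
fromParity-parity-toℕ F.zero           = refl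
fromParity-parity-toℕ (F.suc F.zero)   = refl

parity-toℕ-injective : ∀ {i j : Fin 2} → parity (toℕ i) ≡ parity (toℕ j) → i ≡ j
parity-toℕ-injective {i} {j} e =
  trans (sym (fromParity-parity-toℕ i)) (trans (cong fromParity e) (fromParity-parity-toℕ j))

d∣m+[n∸o]⇔m%d≡o%d : ∀ {d n} m {o} .{{_ : NonZero d}} → d ∣ n → o ≤ n →
                    d ∣ m + (n ∸ o) ⇔ m % d ≡ o % d
d∣m+[n∸o]⇔m%d≡o%d {d} {n} m {o} d∣n o≤n = mk⇔ ⇒ ⇐
  where
  open ≡-Reasoning
  ⇒ : d ∣ m + (n ∸ o) → m % d ≡ o % d
  ⇒ d∣m+[n∸o] = begin
    m % d                  ≡⟨ %-remove-+ʳ m d∣n ⟨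
    (m + n) % d            ≡⟨ cong (λ z → (m + z) % d) (m∸n+n≡m o≤n) ⟨
    (m + (n ∸ o + o)) % d  ≡⟨ cong (_% d) (+-assoc m (n ∸ o) o) ⟨
    (m + (n ∸ o) + o) % d  ≡⟨ %-remove-+ˡ o d∣m+[n∸o] ⟩
    o % d                  ∎
  ⇐ : m % d ≡ o % d → d ∣ m + (n ∸ o)
  ⇐ e = m%n≡0⇒n∣m _ d (begin
    (m + (n ∸ o)) % d               ≡⟨ %-distribˡ-+ m (n ∸ o) d ⟩
    (m % d + (n ∸ o) % d) % d       ≡⟨ cong (λ z → (z + (n ∸ o) % d) % d) e ⟩
    (o % d + (n ∸ o) % d) % d       ≡⟨ %-distribˡ-+ o (n ∸ o) d ⟨
    (o + (n ∸ o)) % d               ≡⟨ cong (_% d) (m+[n∸m]≡n o≤n) ⟩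
    n % d                           ≡⟨ n∣m⇒m%n≡0 n d d∣n ⟩
    0                               ∎)

prime∤⇒coprime : ∀ {p d} → Prime p → ¬ p ∣ d → Coprime d p
prime∤⇒coprime pr p∤d {i} (i∣d , i∣p) with prime⇒irreducible pr i∣p
... | inj₁ i≡1 = i≡1
... | inj₂ refl = contradiction i∣d p∤d

coprime-* : ∀ {d m n} → Coprime d m → Coprime d n → Coprime d (m * n)
coprime-* c₁ c₂ (i∣d , i∣mn) =
  c₂ (i∣d , coprime-divisor (λ (j∣i , j∣m) → c₁ (∣-trans j∣i i∣d , j∣m)) i∣mn)

coprime-*⇔∤×∤ : ∀ {p q d} → Prime p → Prime q → Coprime d (p * q) ⇔ (¬ p ∣ d × ¬ q ∣ d)
coprime-*⇔∤×∤ {p} {q} {d} pr qr = mk⇔ ⇒ ⇐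
  where
  ⇒ : Coprime d (p * q) → ¬ p ∣ d × ¬ q ∣ d
  ⇒ c = (λ p∣d → ¬prime[1] (subst Prime (c (p∣d , m∣m*n q)) pr)) ,
        (λ q∣d → ¬prime[1] (subst Prime (c (q∣d , n∣m*n p)) qr))
  ⇐ : ¬ p ∣ d × ¬ q ∣ d → Coprime d (p * q)
  ⇐ (p∤d , q∤d) = coprime-* (prime∤⇒coprime pr p∤d) (prime∤⇒coprime qr q∤d)

coprime-∸⇒coprime : ∀ {a n} → a ≤ n → Coprime (n ∸ a) n → Coprime a n
coprime-∸⇒coprime {a} {n} a≤n c (i∣a , i∣n) =
  c (∣m+n∣m⇒∣n (subst (_ ∣_) (sym (m+[n∸m]≡n a≤n)) i∣n) i∣a , i∣n)

prime≢2⇒parity≡1ℙ : ∀ {p} → Prime p → p ≢ 2 → parity p ≡ 1ℙ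
prime≢2⇒parity≡1ℙ pr p≢2 = ≢⇒≡⁻¹ λ p-even →
  case prime⇒irreducible pr (parity≡0ℙ⇒2∣ p-even) of λ where
    (inj₁ ())
    (inj₂ 2≡p) → p≢2 (sym 2≡p)

diffMod≡ : ∀ {n} .{{_ : NonZero n}} (x y : Fin n) → diffMod n x y ≡ (toℕ x + (n ∸ toℕ y)) % n
diffMod≡ {suc _} _ _ = refl

diffMod-zero : ∀ {n} (x : Fin (suc n)) → diffMod (suc n) x F.zero ≡ toℕ x
diffMod-zero {n} x = trans ([m+n]%n≡m%n (toℕ x) (suc n)) (m<n⇒m%n≡m (toℕ<n x))

diffMod-suc : ∀ {k} (x y : Fin (2 + k)) → toℕ x ≡ suc (toℕ y) → diffMod (2 + k) x y ≡ 1
diffMod-suc {k} x y e = begin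
  (toℕ x + (n ∸ toℕ y)) % n       ≡⟨ cong (λ z → (z + (n ∸ toℕ y)) % n) e ⟩
  suc (toℕ y + (n ∸ toℕ y)) % n   ≡⟨ cong (λ z → suc z % n) (m+[n∸m]≡n (<⇒≤ (toℕ<n y))) ⟩
  (1 + n) % n                     ≡⟨ [m+n]%n≡m%n 1 n ⟩
  1 % n                           ≡⟨ m<n⇒m%n≡m {n = n} (s≤s (s≤s z≤n)) ⟩
  1                               ∎
  where
  open ≡-Reasoning
  n = 2 + k

diffMod-zero-last : ∀ k → diffMod (2 + k) F.zero (fromℕ (suc k)) ≡ 1
diffMod-zero-last k = begin
  (2 + k ∸ toℕ (fromℕ (suc k))) % (2 + k)
    ≡⟨ cong (λ z → (2 + k ∸ z) % (2 + k)) (toℕ-fromℕ (suc k)) ⟩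
  (1 + k ∸ k) % (2 + k)                    ≡⟨ cong (_% (2 + k)) (m+n∸n≡m 1 k) ⟩
  1 % (2 + k)                              ≡⟨ m<n⇒m%n≡m {n = 2 + k} (s≤s (s≤s z≤n)) ⟩
  1                                        ∎
  where open ≡-Reasoning

∣diffMod⇔%≡ : ∀ {d n} .{{_ : NonZero d}} .{{_ : NonZero n}} → d ∣ n → (x y : Fin n) →
              d ∣ diffMod n x y ⇔ toℕ x % d ≡ toℕ y % d
∣diffMod⇔%≡ {d} {n} d∣n x y = begin
  d ∣ diffMod n x y              ≡⟨ cong (d ∣_) (diffMod≡ x y) ⟩
  d ∣ (toℕ x + (n ∸ toℕ y)) % n  ∼⟨ mk⇔ (∣n∣m%n⇒∣m d∣n) (λ d∣D → %-presˡ-∣ d∣D d∣n) ⟩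
  d ∣ toℕ x + (n ∸ toℕ y)        ∼⟨ d∣m+[n∸o]⇔m%d≡o%d (toℕ x) d∣n (<⇒≤ (toℕ<n y)) ⟩
  toℕ x % d ≡ toℕ y % d          ∎
  where open EquationalReasoning

diffMod≡1⇒adjacent : ∀ {n} (x y : Fin n) → diffMod n x y ≡ 1 → UnitaryAdj n x y
diffMod≡1⇒adjacent {n} _ _ e = trans (cong (λ z → gcd z n) e) (gcd-zeroˡ n)

adjacent-zero⇔coprime : ∀ {n} (x : Fin (suc n)) →
                        UnitaryAdj (suc n) x F.zero ⇔ Coprime (toℕ x) (suc n)
adjacent-zero⇔coprime {n} x = begin
  gcd (diffMod (suc n) x F.zero) (suc n) ≡ 1  ≡⟨ cong (λ D → gcd D (suc n) ≡ 1) (diffMod-zero x) ⟩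
  gcd (toℕ x) (suc n) ≡ 1                     ∼⟨ mk⇔ gcd≡1⇒coprime coprime⇒gcd≡1 ⟩
  Coprime (toℕ x) (suc n)                     ∎
  where open EquationalReasoning

module PrimeToCrown {p} (prime : Prime p) (odd : parity p ≡ 1ℙ) where

  instance
    p≢0 : NonZero p
    p≢0 = prime⇒nonZero prime
    2p≢0 : NonZero (2 * p)
    2p≢0 = m*n≢0 2 p

  -- Writing x = p q + r, the bit q is corrected by the parity of r, so that
  -- the first coordinate of  twist (q , r)  is the parity of x (p is odd).
  twist : Fin 2 × Fin p → Fin 2 × Fin p
  twist (q , r) = fromParity (parity (toℕ q) ℙ.+ parity (toℕ r)) , r

  twist-involutive : ∀ y → twist (twist y) ≡ y
  twist-involutive (q , r) = cong (_, r) (begin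
    fromParity (parity (toℕ (fromParity (pq ℙ.+ pr))) ℙ.+ pr)
      ≡⟨ cong (λ z → fromParity (z ℙ.+ pr)) (parity-toℕ-fromParity (pq ℙ.+ pr)) ⟩
    fromParity (pq ℙ.+ pr ℙ.+ pr)  ≡⟨ cong fromParity (x+y+y≡x pq pr) ⟩
    fromParity pq                  ≡⟨ fromParity-parity-toℕ q ⟩
    q                              ∎)
    where
    open ≡-Reasoning
    pq = parity (toℕ q)
    pr = parity (toℕ r)

  crt : Fin (2 * p) ↔ (Fin 2 × Fin p)
  crt = mk↔ₛ′ twist twist twist-involutive twist-involutive ↔-∘ *↔×

  module _ (x : Fin (2 * p)) where
    private
      q = F.quotient {2} p x
      r = F.remainder {2} p x

      toℕx≡ : toℕ x ≡ p * toℕ q + toℕ r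
      toℕx≡ = trans (cong toℕ (sym (combine-remQuot {2} p x))) (toℕ-combine q r)

    crt-parity : parity (toℕ (proj₁ (Inverse.to crt x))) ≡ parity (toℕ x)
    crt-parity = begin
      parity (toℕ (fromParity (parity (toℕ q) ℙ.+ parity (toℕ r))))
        ≡⟨ parity-toℕ-fromParity _ ⟩
      parity (toℕ q) ℙ.+ parity (toℕ r)
        ≡⟨ cong (λ z → z ℙ.* parity (toℕ q) ℙ.+ parity (toℕ r)) odd ⟨
      parity p ℙ.* parity (toℕ q) ℙ.+ parity (toℕ r)
        ≡⟨ cong (ℙ._+ parity (toℕ r)) (ℙₚ.*-homo-* p (toℕ q)) ⟨
      parity (p * toℕ q) ℙ.+ parity (toℕ r)
        ≡⟨ ℙₚ.+-homo-+ (p * toℕ q) (toℕ r) ⟨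
      parity (p * toℕ q + toℕ r)
        ≡⟨ cong parity toℕx≡ ⟨
      parity (toℕ x)
        ∎
      where open ≡-Reasoning

    crt-residue : toℕ (proj₂ (Inverse.to crt x)) ≡ toℕ x % p
    crt-residue = sym (begin
      toℕ x % p                ≡⟨ cong (_% p) toℕx≡ ⟩
      (p * toℕ q + toℕ r) % p  ≡⟨ %-remove-+ˡ (toℕ r) (m∣m*n (toℕ q)) ⟩
      toℕ r % p                ≡⟨ m<n⇒m%n≡m (toℕ<n r) ⟩
      toℕ r                    ∎)
      where open ≡-Reasoning

  crt-adjacent : ∀ x y → UnitaryAdj (2 * p) x y ⇔ CrownAdj p (Inverse.to crt x) (Inverse.to crt y)
  crt-adjacent x y = begin
    gcd D (2 * p) ≡ 1                    ∼⟨ mk⇔ gcd≡1⇒coprime coprime⇒gcd≡1 ⟩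
    Coprime D (2 * p)                    ∼⟨ coprime-*⇔∤×∤ prime[2] prime ⟩
    (¬ 2 ∣ D × ¬ p ∣ D)                  ∼⟨ ¬-cong-⇔ same-side ×-⇔ ¬-cong-⇔ same-index ⟩
    CrownAdj p (to x) (to y)             ∎
    where
    open EquationalReasoning
    to = Inverse.to crt
    D = diffMod (2 * p) x y
    same-side : 2 ∣ D ⇔ proj₁ (to x) ≡ proj₁ (to y)
    same-side = begin
      2 ∣ D
        ∼⟨ ∣diffMod⇔%≡ (m∣m*n p) x y ⟩
      toℕ x % 2 ≡ toℕ y % 2
        ∼⟨ ⇔-sym (parity≡⇔%2≡ (toℕ x) (toℕ y)) ⟩
      parity (toℕ x) ≡ parity (toℕ y)
        ≡⟨ cong₂ _≡_ (crt-parity x) (crt-parity y) ⟨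
      parity (toℕ (proj₁ (to x))) ≡ parity (toℕ (proj₁ (to y)))
        ∼⟨ mk⇔ parity-toℕ-injective (cong (parity ∘ toℕ)) ⟩
      proj₁ (to x) ≡ proj₁ (to y)
        ∎
    same-index : p ∣ D ⇔ proj₂ (to x) ≡ proj₂ (to y)
    same-index = begin
      p ∣ D                                      ∼⟨ ∣diffMod⇔%≡ (n∣m*n 2) x y ⟩
      toℕ x % p ≡ toℕ y % p                      ≡⟨ cong₂ _≡_ (crt-residue x) (crt-residue y) ⟨
      toℕ (proj₂ (to x)) ≡ toℕ (proj₂ (to y))    ∼⟨ mk⇔ toℕ-injective (cong toℕ) ⟩
      proj₂ (to x) ≡ proj₂ (to y)                ∎

  isCrown : IsCrownUnitary (2 * p)
  isCrown = p , crt , crt-adjacent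

module CrownToPrime {k m} (f : Fin (2 + k) ↔ (Fin 2 × Fin m))
  (adj : ∀ x y → UnitaryAdj (2 + k) x y ⇔ CrownAdj m (Inverse.to f x) (Inverse.to f y)) where

  n : ℕ
  n = 2 + k

  side : Fin n → Parity
  side x = parity (toℕ (proj₁ (Inverse.to f x)))

  s₀ : Parity
  s₀ = side F.zero

  index₀ : Fin m
  index₀ = proj₂ (Inverse.to f F.zero)

  adjacent⇒side≢ : ∀ x y → UnitaryAdj n x y → side x ≢ side y
  adjacent⇒side≢ x y u = proj₁ (Equivalence.to (adj x y) u) ∘ parity-toℕ-injective

  side-parity : ∀ a (a<n : a < n) → side (fromℕ< a<n) ≡ parity a ℙ.+ s₀
  side-parity zero    _     = refl
  side-parity (suc a) a+1<n = begin
    side (fromℕ< a+1<n)       ≡⟨ ≢⇒≡⁻¹ (adjacent⇒side≢ _ _ consecutive) ⟩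
    side (fromℕ< a<n) ⁻¹      ≡⟨ cong _⁻¹ (side-parity a a<n) ⟩
    1ℙ ℙ.+ (parity a ℙ.+ s₀)  ≡⟨ ℙₚ.+-assoc 1ℙ (parity a) s₀ ⟨
    1ℙ ℙ.+ parity a ℙ.+ s₀    ≡⟨ cong (ℙ._+ s₀) (ℙₚ.+-homo-+ 1 a) ⟨
    parity (suc a) ℙ.+ s₀     ∎
    where
    open ≡-Reasoning
    a<n = <-trans (n<1+n a) a+1<n
    consecutive : UnitaryAdj n (fromℕ< a+1<n) (fromℕ< a<n)
    consecutive = diffMod≡1⇒adjacent (fromℕ< a+1<n) (fromℕ< a<n) (diffMod-suc (fromℕ< a+1<n) (fromℕ< a<n)
      (trans (toℕ-fromℕ< a+1<n) (cong suc (sym (toℕ-fromℕ< a<n)))))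

  side≡parity : ∀ x → side x ≡ parity (toℕ x) ℙ.+ s₀
  side≡parity x = trans (cong side (sym (fromℕ<-toℕ x (toℕ<n x)))) (side-parity (toℕ x) (toℕ<n x))

  -- The last vertex n - 1 is adjacent to 0, so n - 1 is odd.
  n-even : parity n ≡ 0ℙ
  n-even = trans (ℙₚ.+-homo-+ 1 (suc k)) (cong _⁻¹ (≢⇒≡⁻¹ last-odd))
    where
    last = fromℕ (suc k)
    last-odd : parity (suc k) ≢ 0ℙ
    last-odd e = adjacent⇒side≢ F.zero last (diffMod≡1⇒adjacent F.zero last (diffMod-zero-last k)) (sym (begin
      side last                 ≡⟨ side≡parity last ⟩
      parity (toℕ last) ℙ.+ s₀  ≡⟨ cong (λ z → parity z ℙ.+ s₀) (toℕ-fromℕ (suc k)) ⟩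
      parity (suc k) ℙ.+ s₀     ≡⟨ cong (ℙ._+ s₀) e ⟩
      s₀                        ∎))
      where open ≡-Reasoning

  -- The vertex matched with 0 in the removed perfect matching.
  partner : Fin n
  partner = Inverse.from f (fromParity (s₀ ⁻¹) , index₀)

  w : ℕ
  w = toℕ partner

  w≤n : w ≤ n
  w≤n = <⇒≤ (toℕ<n partner)

  w-odd : parity w ≡ 1ℙ
  w-odd = ℙₚ.+-cancelʳ-≡ s₀ (parity w) 1ℙ (trans (sym (side≡parity partner)) side-partner)
    where
    side-partner : side partner ≡ s₀ ⁻¹
    side-partner = trans (cong (parity ∘ toℕ ∘ proj₁) (Inverse.strictlyInverseˡ f _))
                         (parity-toℕ-fromParity _)

  w-nonunit : ¬ Coprime w n
  w-nonunit c = proj₂ crown refl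
    where
    crown : CrownAdj m (fromParity (s₀ ⁻¹) , index₀) (Inverse.to f F.zero)
    crown = subst (λ v → CrownAdj m v (Inverse.to f F.zero)) (Inverse.strictlyInverseˡ f _)
                  (Equivalence.to (adj partner F.zero) (Equivalence.from (adjacent-zero⇔coprime partner) c))

  -- 0 is adjacent to every odd vertex except its partner.
  odd-nonunit⇒≡w : ∀ {a} → a < n → parity a ≡ 1ℙ → ¬ Coprime a n → a ≡ w
  odd-nonunit⇒≡w {a} a<n a-odd a-nonunit = trans (sym (toℕ-fromℕ< a<n)) (cong toℕ x≡partner)
    where
    x = fromℕ< a<n
    side-x : side x ≡ s₀ ⁻¹
    side-x = trans (side-parity a a<n) (cong (ℙ._+ s₀) a-odd)
    other-side : proj₁ (Inverse.to f x) ≢ proj₁ (Inverse.to f F.zero)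
    other-side e = ℙₚ.p≢p⁻¹ s₀ (trans (sym (cong (parity ∘ toℕ) e)) side-x)
    same-index : proj₂ (Inverse.to f x) ≡ index₀
    same-index = decidable-stable (proj₂ (Inverse.to f x) F.≟ index₀) λ different →
      a-nonunit (subst (λ b → Coprime b n) (toℕ-fromℕ< a<n)
        (Equivalence.to (adjacent-zero⇔coprime x)
          (Equivalence.from (adj x F.zero) (other-side , different))))
    x≡partner : x ≡ partner
    x≡partner = trans (sym (Inverse.strictlyInverseʳ f x)) (cong (Inverse.from f)
      (cong₂ _,_ (trans (sym (fromParity-parity-toℕ _)) (cong fromParity side-x)) same-index))

  w≢0 : w ≢ 0
  w≢0 e = ℙₚ.p≢p⁻¹ 0ℙ (trans (cong parity (sym e)) w-odd)

  -- n - w is again odd and shares the factor of w with n.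
  n≡2w : n ≡ 2 * w
  n≡2w = begin
    n            ≡⟨ m+[n∸m]≡n w≤n ⟨
    w + (n ∸ w)  ≡⟨ cong (w +_) n∸w≡w ⟩
    w + w        ≡⟨ cong (w +_) (+-identityʳ w) ⟨
    2 * w        ∎
    where
    open ≡-Reasoning
    n∸w-odd : parity (n ∸ w) ≡ 1ℙ
    n∸w-odd = ℙₚ.+-cancelʳ-≡ 1ℙ (parity (n ∸ w)) 1ℙ (begin
      parity (n ∸ w) ℙ.+ 1ℙ          ≡⟨ cong (parity (n ∸ w) ℙ.+_) w-odd ⟨
      parity (n ∸ w) ℙ.+ parity w    ≡⟨ ℙₚ.+-homo-+ (n ∸ w) w ⟨
      parity (n ∸ w + w)             ≡⟨ cong parity (m∸n+n≡m w≤n) ⟩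
      parity n                       ≡⟨ n-even ⟩
      0ℙ                             ∎)
    n∸w≡w : n ∸ w ≡ w
    n∸w≡w = odd-nonunit⇒≡w (∸-monoʳ-< (n≢0⇒n>0 w≢0) w≤n) n∸w-odd
                            (w-nonunit ∘ coprime-∸⇒coprime w≤n)

  w-prime : Prime w
  w-prime = irreducible⇒prime {{n>1⇒nonTrivial 1<w}} irreducible
    where
    instance
      w≢0′ : NonZero w
      w≢0′ = ≢-nonZero w≢0
    w∣n : w ∣ n
    w∣n = subst (w ∣_) (sym n≡2w) (n∣m*n 2)
    1<w : 1 < w
    1<w = ≤∧≢⇒< (n≢0⇒n>0 w≢0) λ 1≡w →
      w-nonunit (subst (λ b → Coprime b n) 1≡w (λ (i∣1 , _) → ∣1⇒≡1 i∣1))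
    irreducible : Irreducible w
    irreducible {d} d∣w with d ≟ 1
    ... | yes d≡1 = inj₁ d≡1
    ... | no  d≢1 = inj₂ (odd-nonunit⇒≡w (≤-<-trans (∣⇒≤ d∣w) (toℕ<n partner))
                                          (∣⇒parity≡1ℙ d∣w w-odd)
                                          (λ c → d≢1 (c (∣-refl , ∣-trans d∣w w∣n))))

  n≡2*oddPrime : Σ[ p ∈ ℕ ] (Prime p × p ≢ 2 × n ≡ 2 * p)
  n≡2*oddPrime =
    w , w-prime , (λ w≡2 → ℙₚ.p≢p⁻¹ 0ℙ (trans (cong parity (sym w≡2)) w-odd)) , n≡2w

mainTheorem3 : (n : ℕ) → 2 ≤ n →
    (IsCrownUnitary n ⇔ (Σ[ p ∈ ℕ ] (Prime p × p ≢ 2 × n ≡ 2 * p)))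
mainTheorem3 1 (s≤s ())
mainTheorem3 (suc (suc k)) _ = mk⇔
  (λ (_ , f , adj) → CrownToPrime.n≡2*oddPrime f adj)
  (λ (p , p-prime , p≢2 , n≡2p) →
     subst IsCrownUnitary (sym n≡2p)
       (PrimeToCrown.isCrown p-prime (prime≢2⇒parity≡1ℙ p-prime p≢2)))
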